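{- Let $N \geq 4$ be an even integer and let $\mathbb{U}=\{1,\dots,N\}$. Let $C=(C_{i,j})_{1\le i<j\le N}$ be real numbers (compatibilities, with $C_{j,i}:=C_{i,j}$), unknown to an observer. An observation consists of choosing a pairing $S$ of $\mathbb{U}$ and learning the value $C_{\mathrm{sum}}(S)=\sum_{\{i,j\}\in S} C_{i,j}$. Define $\tilde{C}_{i,j}$ for $1\le i<j\le N$ by $$\tilde{C}_{i,j}=\begin{cases}0, & \text{if } i=1 \text{ or } j=1,\\ C_{i,j}-C_{1,i}-C_{1,j}+\frac{2}{N-2}\sum_{k=2}^{N}C_{1,k}, & \text{otherwise.}\end{cases}$$ Then the minimum number of observations required to know the entire set of values $\tilde{C}=(\tilde C_{i,j})$ (i.e., the minimum number of pairings whose total compatibilities determine all $\tilde{C}_{i,j}$ uniquely, for every choice of $C$) is $(N-1)(N-2)/2$.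
   Context: A pairing of $\mathbb{U}=\{1,\dots,N\}$ ($N$ even) is a set $S$ of two-element subsets $\{i,j\}\subseteq \mathbb{U}$ ($i\ne j$) that are pairwise disjoint and whose union is $\mathbb{U}$; i.e., a partition of $\mathbb{U}$ into $N/2$ pairs (a perfect matching of the complete graph on $\mathbb{U}$). The individual compatibilities $C_{i,j}$ cannot be observed directly; only totals $C_{\mathrm{sum}}(S)$ for chosen pairings $S$ are observed.
   Formalization: The compatibilities $C_{i,j}$ are taken in the rationals instead of the reals. -}

module Defs where

open import Data.Nat as ℕ using (ℕ; zero; suc; _∸_; _≤_; _<_; _≡ᵇ_; _<ᵇ_)
open import Data.Nat.DivMod using (_/_)
open import Data.Fin using (Fin; toℕ)
open import Data.Bool using (if_then_else_)
open import Data.List using (List; foldr; allFin; upTo; map; length)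
open import Data.List.Membership.Propositional using (_∈_)
open import Data.Integer using (+_)
open import Data.Rational as ℚ using (ℚ; 0ℚ; _+_; _-_; _*_)
open import Relation.Binary.PropositionalEquality using (_≡_; _≢_)

-- A pairing of U = {1,...,N}, encoded on Fin N (element i : Fin N stands
-- for the label 1 + toℕ i) as a fixed-point-free involution:
-- i is paired with p i.
record Pairing (N : ℕ) : Set where
  field
    p     : Fin N → Fin N
    invol : ∀ i → p (p i) ≡ i
    nofix : ∀ i → p i ≢ i
open Pairing public

lbl : ∀ {N} → Fin N → ℕ
lbl i = suc (toℕ i)

ΣFin : (N : ℕ) → (Fin N → ℚ) → ℚ
ΣFin N f = foldr (λ i acc → f i + acc) 0ℚ (allFin N)

-- Compatibilities: C i j (labels 1..N); only the values with i < j are used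
-- (C_{j,i} := C_{i,j}).
Compat : Set
Compat = ℕ → ℕ → ℚ

-- C_sum(S) = sum over pairs {i,j} ∈ S (each counted once, with i < j) of C_{i,j}
Csum : ∀ {N} → Pairing N → Compat → ℚ
Csum {N} S C = ΣFin N (λ i →
  if lbl i <ᵇ lbl (p S i) then C (lbl i) (lbl (p S i)) else 0ℚ)

-- 2 / (N - 2)  (N ≥ 4 in the theorem, so the fallback 0 is never used)
coef : ℕ → ℚ
coef (suc (suc (suc m))) = (+ 2) ℚ./ suc m
coef _ = 0ℚ

-- sum_{k=2}^{N} C_{1,k}
sum1 : ℕ → Compat → ℚ
sum1 N C = foldr (λ k acc → C 1 (suc (suc k)) + acc) 0ℚ (upTo (N ∸ 1))

Ctilde : ℕ → Compat → ℕ → ℕ → ℚ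
Ctilde N C i j =
  if (i ≡ᵇ 1) Data.Bool.∨ (j ≡ᵇ 1) then 0ℚ
  else C i j - C 1 i - C 1 j + coef N * sum1 N C

Determines : (N : ℕ) → List (Pairing N) → Set
Determines N Ss = ∀ (C C' : Compat) →
  (∀ {S} → S ∈ Ss → Csum S C ≡ Csum S C') →
  ∀ i j → 1 ≤ i → i < j → j ≤ N → Ctilde N C i j ≡ Ctilde N C' i j

target : ℕ → ℕ
target N = ((N ∸ 1) ℕ.* (N ∸ 2)) / 2

{-# OPTIONS --safe #-}
-- C̃ is linear in C, so both bounds concern a difference D of two compatibility matrices.
--
-- If no observed pairing distinguishes C from C′, put D = C − C′ and subtract
-- from it the sum form α(i) + α(j) with α(i) = D₁ᵢ; every pairing has the same total Σ α on a
-- sum form, so the remainder G has zero first row and all observed pairings still agree on G.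
-- Exchanging the partners of a and b changes a total by G(a,qb) + G(b,qa) − G(a,qa) − G(b,qb),
-- and in a suitable family of (N−1)(N−2)/2 pairings each new one differs from an earlier one
-- by such an exchange, forcing one new entry of G to equal an old one.  Hence G is a constant w off the first
-- row, the common total is (N/2 − 1) w = −Σ α, and C̃(D) = w + (2/(N−2)) Σ α = 0.
--
-- Fewer observations than the (N−1)(N−2)/2 entries Dᵢⱼ, 2 ≤ i < j ≤ N, leave
-- by Gaussian elimination a nonzero D supported on those entries with all totals zero; as its
-- first row vanishes, C̃(D) = D ≠ 0 = C̃(0).

module Submission where

open import Defs

open import Algebra.Bundles using (Ring)
open import Data.Bool using (true; false; if_then_else_; T)
open import Data.Empty using (⊥-elim)
open import Data.Fin as Fin using (Fin; toℕ; fromℕ<)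
import Data.Fin.Properties as FP
import Data.Integer as ℤ
import Data.Integer.Properties as ℤP
open import Data.List using (List; []; _∷_; _++_; foldr; map; length; removeAt; tabulate; applyUpTo; allFin; upTo)
import Data.List.Properties as LP
open import Data.List.Membership.Propositional using (_∈_; _∉_)
open import Data.List.Membership.Propositional.Properties using (∈-++⁺ˡ; ∈-++⁺ʳ; ∈-++⁻; ∈-map⁺)
open import Data.List.Relation.Unary.All as All using (All; []; _∷_)
open import Data.List.Relation.Unary.All.Properties as All using (¬All⇒Any¬)
open import Data.List.Relation.Unary.AllPairs using ([]; _∷_)
open import Data.List.Relation.Unary.Any as Any using (Any; here; there)
open import Data.List.Relation.Unary.Any.Properties using (lookup-result)
open import Data.List.Relation.Unary.Unique.Propositional using (Unique)
open import Data.List.Relation.Unary.Unique.Propositional.Properties using (++⁺)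
open import Data.Nat as ℕ using (ℕ; zero; suc; _∸_; _≤_; _<_; _≡ᵇ_; _<ᵇ_; z≤n; s≤s; z<s; s<s)
open import Data.Nat.Divisibility using (_∣_; divides)
open import Data.Nat.DivMod using (_/_; m*n/n≡m)
import Data.Nat.Properties as ℕP
open import Data.Nat.Properties using (_≟_; _<?_)
open import Data.Nat.Tactic.RingSolver using (solve-∀)
open import Data.Product as Product using (Σ-syntax; _×_; _,_; proj₁; proj₂; curry)
open import Data.Product.Properties using (≡-dec)
open import Data.Rational as ℚ using (ℚ; 0ℚ; 1ℚ; _+_; _*_; _-_; -_; 1/_; toℚᵘ)
import Data.Rational.Properties as ℚP
open import Data.Rational.Solver using (module +-*-Solver)
open import Data.Rational.Unnormalised as ℚᵘ using (mkℚᵘ; *≡*)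
import Data.Rational.Unnormalised.Properties as ℚᵘP
open import Data.Sum using (inj₁; inj₂)
open import Data.Unit using (tt)
open import Function using (_∘_)
open import Relation.Binary.Definitions using (tri<; tri≈; tri>; DecidableEquality)
open import Relation.Binary.PropositionalEquality hiding (J)
open import Relation.Nullary using (¬_; yes; no; does; _×-dec_)
open import Relation.Nullary.Decidable using (dec-true; dec-false)
open import Relation.Nullary.Reflects using (ofʸ; ofⁿ)

open import Algebra.Properties.Semiring.Mult (Ring.semiring ℚP.+-*-ring) using (×-assoc-*) renaming (_×_ to _×ℚ_)
open import Algebra.Properties.Group ℚP.+-0-group using (∙-cancelʳ; x∙y⁻¹≈ε⇒x≈y; x≈y⇒x∙y⁻¹≈ε)
open +-*-Solver using (solve; _:+_; _:*_; _:-_; :-_; _:=_; con)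

-- Finite sums

sumBelow : ℕ → (ℕ → ℚ) → ℚ
sumBelow zero    f = 0ℚ
sumBelow (suc n) f = f 0 + sumBelow n (λ x → f (suc x))

sumBelow-cong : ∀ n {f g : ℕ → ℚ} → (∀ x → x < n → f x ≡ g x) → sumBelow n f ≡ sumBelow n g
sumBelow-cong zero    f≗g = refl
sumBelow-cong (suc n) f≗g = cong₂ _+_ (f≗g 0 z<s) (sumBelow-cong n (λ x x<n → f≗g (suc x) (s<s x<n)))

-- ΣFin N is listSum (allFin N), and sum1 is a listSum over upTo, by definition.
listSum : {A : Set} → List A → (A → ℚ) → ℚ
listSum xs f = foldr (λ x acc → f x + acc) 0ℚ xs

listSum-cong : ∀ {A : Set} (xs : List A) {f g : A → ℚ} → (∀ {x} → x ∈ xs → f x ≡ g x) →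
               listSum xs f ≡ listSum xs g
listSum-cong []       f≗g = refl
listSum-cong (x ∷ xs) f≗g = cong₂ _+_ (f≗g (here refl)) (listSum-cong xs λ x∈xs → f≗g (there x∈xs))

listSum-0 : ∀ {A : Set} (xs : List A) → listSum xs (λ _ → 0ℚ) ≡ 0ℚ
listSum-0 []       = refl
listSum-0 (x ∷ xs) = trans (ℚP.+-identityˡ _) (listSum-0 xs)

listSum-+ : ∀ {A : Set} (xs : List A) (f g : A → ℚ) →
            listSum xs (λ x → f x + g x) ≡ listSum xs f + listSum xs g
listSum-+ []       f g = refl
listSum-+ (x ∷ xs) f g = trans (cong (f x + g x +_) (listSum-+ xs f g))
  (solve 4 (λ a b c d → (a :+ b) :+ (c :+ d) := (a :+ c) :+ (b :+ d)) refl (f x) (g x) _ _)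

listSum-* : ∀ {A : Set} (xs : List A) r (f : A → ℚ) → listSum xs (λ x → r * f x) ≡ r * listSum xs f
listSum-* []       r f = sym (ℚP.*-zeroʳ r)
listSum-* (x ∷ xs) r f = trans (cong (r * f x +_) (listSum-* xs r f)) (sym (ℚP.*-distribˡ-+ r (f x) _))

listSum-− : ∀ {A : Set} (xs : List A) (f g : A → ℚ) →
            listSum xs (λ x → f x - g x) ≡ listSum xs f - listSum xs g
listSum-− []       f g = sym (ℚP.+-inverseʳ 0ℚ)
listSum-− (x ∷ xs) f g = trans (cong (f x - g x +_) (listSum-− xs f g))
  (solve 4 (λ a b c d → (a :- b) :+ (c :- d) := (a :+ c) :- (b :+ d)) refl (f x) (g x) _ _)

listSum-tabulate : ∀ n {A : Set} (h : Fin n → A) (f : A → ℚ) (g : ℕ → ℚ) → (∀ i → f (h i) ≡ g (toℕ i)) →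
                   listSum (tabulate h) f ≡ sumBelow n g
listSum-tabulate zero    h f g f∘h≗g = refl
listSum-tabulate (suc n) h f g f∘h≗g =
  cong₂ _+_ (f∘h≗g Fin.zero) (listSum-tabulate n (h ∘ Fin.suc) f (g ∘ suc) (f∘h≗g ∘ Fin.suc))

listSum-applyUpTo : ∀ n (h : ℕ → ℕ) (f : ℕ → ℚ) → listSum (applyUpTo h n) f ≡ sumBelow n (f ∘ h)
listSum-applyUpTo zero    h f = refl
listSum-applyUpTo (suc n) h f = cong (f (h 0) +_) (listSum-applyUpTo n (h ∘ suc) f)

-- Through _≡ᵇ_, deleteAt (suc a) f (suc x) reduces to deleteAt a (f ∘ suc) x.
deleteAt : ℕ → (ℕ → ℚ) → ℕ → ℚ
deleteAt a f x = if x ≡ᵇ a then 0ℚ else f x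

deleteAt-≢ : ∀ a f {x} → x ≢ a → deleteAt a f x ≡ f x
deleteAt-≢ a f {x} x≢a with x ≡ᵇ a in eq
... | true  = ⊥-elim (x≢a (ℕP.≡ᵇ⇒≡ x a (subst T (sym eq) tt)))
... | false = refl

deleteAt-cong : ∀ a {f g} x → (x ≢ a → f x ≡ g x) → deleteAt a f x ≡ deleteAt a g x
deleteAt-cong a x f≗g with x ≡ᵇ a in eq
... | true  = refl
... | false = f≗g (λ x≡a → subst T eq (ℕP.≡⇒≡ᵇ x a x≡a))

deleteAll : List ℕ → (ℕ → ℚ) → ℕ → ℚ
deleteAll []       f = f
deleteAll (a ∷ as) f = deleteAll as (deleteAt a f)

deleteAll-cong : ∀ as {f g} x → (x ∉ as → f x ≡ g x) → deleteAll as f x ≡ deleteAll as g x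
deleteAll-cong []       x f≗g = f≗g λ ()
deleteAll-cong (a ∷ as) {f} {g} x f≗g =
  deleteAll-cong as {deleteAt a f} {deleteAt a g} x λ x∉as → deleteAt-cong a {f} {g} x λ x≢a → f≗g λ { (here x≡a) → x≢a x≡a ; (there x∈as) → x∉as x∈as }

sumBelow-extract : ∀ n f {a} → a < n → sumBelow n f ≡ f a + sumBelow n (deleteAt a f)
sumBelow-extract (suc n) f {zero} _ = cong (f 0 +_) (sym (ℚP.+-identityˡ _))
sumBelow-extract (suc n) f {suc a} (s<s a<n) = begin
  f 0 + sumBelow n (λ x → f (suc x))
    ≡⟨ cong (f 0 +_) (sumBelow-extract n (λ x → f (suc x)) a<n) ⟩
  f 0 + (f (suc a) + sumBelow n (deleteAt a (λ x → f (suc x))))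
    ≡⟨ solve 3 (λ p q r → p :+ (q :+ r) := q :+ (p :+ r)) refl (f 0) (f (suc a)) _ ⟩
  f (suc a) + (f 0 + sumBelow n (deleteAt a (λ x → f (suc x))))
    ∎
  where open ≡-Reasoning

sumBelow-extractAll : ∀ n f {as} → Unique as → All (_< n) as →
                      sumBelow n f ≡ listSum as f + sumBelow n (deleteAll as f)
sumBelow-extractAll n f {[]}     []               []           = sym (ℚP.+-identityˡ _)
sumBelow-extractAll n f {a ∷ as} (a∉as ∷ as-uniq) (a<n ∷ as<n) = begin
  sumBelow n f
    ≡⟨ sumBelow-extract n f a<n ⟩
  f a + sumBelow n (deleteAt a f)
    ≡⟨ cong (f a +_) (sumBelow-extractAll n (deleteAt a f) as-uniq as<n) ⟩
  f a + (listSum as (deleteAt a f) + sumBelow n (deleteAll (a ∷ as) f))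
    ≡⟨ cong (λ s → f a + (s + sumBelow n (deleteAll (a ∷ as) f))) (listSum-cong as λ x∈as → deleteAt-≢ a f (≢-sym (All.lookup a∉as x∈as))) ⟩
  f a + (listSum as f + sumBelow n (deleteAll (a ∷ as) f))
    ≡⟨ sym (ℚP.+-assoc (f a) _ _) ⟩
  listSum (a ∷ as) f + sumBelow n (deleteAll (a ∷ as) f)
    ∎
  where open ≡-Reasoning

sumBelow-agreeOff : ∀ n f g {as} → Unique as → All (_< n) as → (∀ x → x ∉ as → f x ≡ g x) →
                    sumBelow n f ≡ sumBelow n g - listSum as g + listSum as f
sumBelow-agreeOff n f g {as} as-uniq as<n f≗g = begin
  sumBelow n f
    ≡⟨ sumBelow-extractAll n f as-uniq as<n ⟩
  listSum as f + sumBelow n (deleteAll as f)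
    ≡⟨ cong (listSum as f +_) (sumBelow-cong n λ x _ → deleteAll-cong as x (f≗g x)) ⟩
  listSum as f + sumBelow n (deleteAll as g)
    ≡⟨ solve 3 (λ F G R → F :+ R := (G :+ R) :- G :+ F) refl (listSum as f) (listSum as g) _ ⟩
  (listSum as g + sumBelow n (deleteAll as g)) - listSum as g + listSum as f
    ≡⟨ cong (λ s → s - listSum as g + listSum as f) (sym (sumBelow-extractAll n g as-uniq as<n)) ⟩
  sumBelow n g - listSum as g + listSum as f
    ∎
  where open ≡-Reasoning

-- Pairings as fixed-point-free involutions

transpose : ℕ → ℕ → ℕ → ℕ
transpose a b x with does (x ≟ a)
... | true  = b
... | false with does (x ≟ b)
...   | true  = a
...   | false = x

transpose-matchˡ : ∀ a b → transpose a b a ≡ b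
transpose-matchˡ a b rewrite dec-true (a ≟ a) refl = refl

transpose-matchʳ : ∀ a b → transpose a b b ≡ a
transpose-matchʳ a b with b ≟ a
... | yes b≡a rewrite dec-true (b ≟ a) b≡a = b≡a
... | no  b≢a rewrite dec-false (b ≟ a) b≢a | dec-true (b ≟ b) refl = refl

transpose-other : ∀ a b {x} → x ≢ a → x ≢ b → transpose a b x ≡ x
transpose-other a b {x} x≢a x≢b rewrite dec-false (x ≟ a) x≢a | dec-false (x ≟ b) x≢b = refl

transpose-involutive : ∀ a b x → transpose a b (transpose a b x) ≡ x
transpose-involutive a b x with x ≟ a | x ≟ b
... | yes refl | _        = trans (cong (transpose x b) (transpose-matchˡ x b)) (transpose-matchʳ x b)
... | no  _    | yes refl = trans (cong (transpose a x) (transpose-matchʳ a x)) (transpose-matchˡ a x)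
... | no  x≢a  | no  x≢b  = trans (cong (transpose a b) (transpose-other a b x≢a x≢b)) (transpose-other a b x≢a x≢b)

transpose-self : ∀ a x → transpose a a x ≡ x
transpose-self a x with x ≟ a
... | yes refl = transpose-matchˡ x x
... | no  x≢a  = transpose-other a a x≢a x≢a

transpose-< : ∀ {N a b x} → a < N → b < N → x < N → transpose a b x < N
transpose-< {a = a} {b} {x} a<N b<N x<N with x ≟ a | x ≟ b
... | yes refl | _        = subst (_< _) (sym (transpose-matchˡ x b)) b<N
... | no  _    | yes refl = subst (_< _) (sym (transpose-matchʳ a x)) a<N
... | no  x≢a  | no  x≢b  = subst (_< _) (sym (transpose-other a b x≢a x≢b)) x<N

record IsPairing (N : ℕ) (q : ℕ → ℕ) : Set where
  field
    involutive : ∀ x → q (q x) ≡ x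
    fixfree    : ∀ x → q x ≢ x
    bounded    : ∀ {x} → x < N → q x < N
open IsPairing

toPairing : ∀ {N q} → IsPairing N q → Pairing N
toPairing {N} {q} q-pairs = record
  { p     = λ i → fromℕ< (bounded q-pairs (FP.toℕ<n i))
  ; invol = λ i → FP.toℕ-injective (begin
      toℕ (fromℕ< (bounded q-pairs (FP.toℕ<n (fromℕ< _)))) ≡⟨ FP.toℕ-fromℕ< _ ⟩
      q (toℕ (fromℕ< _))                                   ≡⟨ cong q (FP.toℕ-fromℕ< _) ⟩
      q (q (toℕ i))                                        ≡⟨ involutive q-pairs (toℕ i) ⟩
      toℕ i                                                ∎)
  ; nofix = λ i eq → fixfree q-pairs (toℕ i) (trans (sym (FP.toℕ-fromℕ< _)) (cong toℕ eq))
  }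
  where open ≡-Reasoning

conjugateBy : ℕ → ℕ → (ℕ → ℕ) → ℕ → ℕ
conjugateBy a b q x = transpose a b (q (transpose a b x))

conjugateBy-isPairing : ∀ {N a b q} → a < N → b < N → IsPairing N q → IsPairing N (conjugateBy a b q)
conjugateBy-isPairing {N} {a} {b} {q} a<N b<N q-pairs = record
  { involutive = λ x → begin
      τ (q (τ (τ (q (τ x))))) ≡⟨ cong (τ ∘ q) (transpose-involutive a b (q (τ x))) ⟩
      τ (q (q (τ x)))         ≡⟨ cong τ (involutive q-pairs (τ x)) ⟩
      τ (τ x)                 ≡⟨ transpose-involutive a b x ⟩
      x                       ∎
  ; fixfree = λ x eq → fixfree q-pairs (τ x)
      (trans (sym (transpose-involutive a b (q (τ x)))) (cong τ eq))
  ; bounded = λ x<N → transpose-< a<N b<N (bounded q-pairs (transpose-< a<N b<N x<N))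
  }
  where
  open ≡-Reasoning
  τ : ℕ → ℕ
  τ = transpose a b

conjugateBy-self : ∀ a q x → conjugateBy a a q x ≡ q x
conjugateBy-self a q x = trans (transpose-self a _) (cong q (transpose-self a x))

conjugateBy-partner : ∀ {q} → (∀ x → q (q x) ≡ x) → ∀ a x → conjugateBy a (q a) q x ≡ q x
conjugateBy-partner {q} q-invol a x with x ≟ a | x ≟ q a
... | yes refl | _ = begin
  τ (q (τ x))   ≡⟨ cong (τ ∘ q) (transpose-matchˡ x (q x)) ⟩
  τ (q (q x))   ≡⟨ cong τ (q-invol x) ⟩
  τ x           ≡⟨ transpose-matchˡ x (q x) ⟩
  q x           ∎
  where
  open ≡-Reasoning
  τ : ℕ → ℕ
  τ = transpose x (q x)
... | no _ | yes refl = begin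
  τ (q (τ (q a))) ≡⟨ cong (τ ∘ q) (transpose-matchʳ a (q a)) ⟩
  τ (q a)         ≡⟨ transpose-matchʳ a (q a) ⟩
  a               ≡⟨ sym (q-invol a) ⟩
  q (q a)         ∎
  where
  open ≡-Reasoning
  τ : ℕ → ℕ
  τ = transpose a (q a)
... | no x≢a | no x≢qa =
  trans (cong (transpose a (q a) ∘ q) (transpose-other a (q a) x≢a x≢qa))
        (transpose-other a (q a) (λ qx≡a → x≢qa (trans (sym (q-invol x)) (cong q qx≡a)))
                                  (λ qx≡qa → x≢a (trans (sym (q-invol x)) (trans (cong q qx≡qa) (q-invol a)))))

-- Transpositions outside [0, N) are ignored, so that every list of them yields a pairing.
conjugate : ℕ → ℕ × ℕ → (ℕ → ℕ) → ℕ → ℕ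
conjugate N (a , b) q with a <? N ×-dec b <? N
... | yes _ = conjugateBy a b q
... | no  _ = q

conjugate-isPairing : ∀ {N q} t → IsPairing N q → IsPairing N (conjugate N t q)
conjugate-isPairing {N} (a , b) q-pairs with a <? N ×-dec b <? N
... | yes (a<N , b<N) = conjugateBy-isPairing a<N b<N q-pairs
... | no  _           = q-pairs

conjugate-inRange : ∀ {N a b} q → a < N → b < N → conjugate N (a , b) q ≡ conjugateBy a b q
conjugate-inRange {N} {a} {b} q a<N b<N with a <? N ×-dec b <? N
... | yes _ = refl
... | no  ¬range = ⊥-elim (¬range (a<N , b<N))

twice : ℕ → ℕ
twice zero    = zero
twice (suc k) = suc (suc (twice k))

twice≡+ : ∀ k → twice k ≡ k ℕ.+ k
twice≡+ zero    = refl
twice≡+ (suc k) = cong suc (trans (cong suc (twice≡+ k)) (sym (ℕP.+-suc k k)))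

twice-mono-≤ : ∀ {m n} → m ≤ n → twice m ≤ twice n
twice-mono-≤ z≤n       = z≤n
twice-mono-≤ (s≤s m≤n) = s≤s (s≤s (twice-mono-≤ m≤n))

adjacent : ℕ → ℕ
adjacent zero          = 1
adjacent (suc zero)    = 0
adjacent (suc (suc x)) = suc (suc (adjacent x))

adjacent-even : ∀ j → adjacent (twice j) ≡ suc (twice j)
adjacent-even zero    = refl
adjacent-even (suc j) = cong (suc ∘ suc) (adjacent-even j)

adjacent-odd : ∀ j → adjacent (suc (twice j)) ≡ twice j
adjacent-odd zero    = refl
adjacent-odd (suc j) = cong (suc ∘ suc) (adjacent-odd j)

adjacent-isPairing : ∀ k → IsPairing (twice k) adjacent
adjacent-isPairing k = record
  { involutive = involutive′ ; fixfree = fixfree′ ; bounded = bounded′ k }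
  where
  involutive′ : ∀ x → adjacent (adjacent x) ≡ x
  involutive′ zero          = refl
  involutive′ (suc zero)    = refl
  involutive′ (suc (suc x)) = cong (suc ∘ suc) (involutive′ x)
  fixfree′ : ∀ x → adjacent x ≢ x
  fixfree′ (suc (suc x)) eq = fixfree′ x (ℕP.suc-injective (ℕP.suc-injective eq))
  bounded′ : ∀ k {x} → x < twice k → adjacent x < twice k
  bounded′ (suc k) {zero}        _                = s<s z<s
  bounded′ (suc k) {suc zero}    _                = z<s
  bounded′ (suc k) {suc (suc x)} (s<s (s<s x<2k)) = s<s (s<s (bounded′ k x<2k))

pairingOf : ℕ → List (ℕ × ℕ) → ℕ → ℕ
pairingOf N = foldr (conjugate N) adjacent

pairingOf-isPairing : ∀ k ts → IsPairing (twice k) (pairingOf (twice k) ts)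
pairingOf-isPairing k []       = adjacent-isPairing k
pairingOf-isPairing k (t ∷ ts) = conjugate-isPairing t (pairingOf-isPairing k ts)

-- Total compatibility of a pairing

-- Vertices are 0-based: index x carries the label x + 1 used by Csum.
summand : Compat → ℕ → ℕ → ℚ
summand C x y = if x <ᵇ y then C (suc x) (suc y) else 0ℚ

entry : Compat → ℕ → ℕ → ℚ
entry C x y = if x <ᵇ y then C (suc x) (suc y) else C (suc y) (suc x)

summand-pair : ∀ C {x y} → x ≢ y → summand C x y + summand C y x ≡ entry C x y
summand-pair C {x} {y} x≢y with x <ᵇ y | ℕP.<ᵇ-reflects-< x y | y <ᵇ x | ℕP.<ᵇ-reflects-< y x
... | true  | ofʸ x<y | true  | ofʸ y<x = ⊥-elim (ℕP.<-asym x<y y<x)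
... | true  | _       | false | _       = ℚP.+-identityʳ _
... | false | _       | true  | _       = ℚP.+-identityˡ _
... | false | ofⁿ x≮y | false | ofⁿ y≮x = ⊥-elim (x≢y (ℕP.≤-antisym (ℕP.≮⇒≥ y≮x) (ℕP.≮⇒≥ x≮y)))

entry-< : ∀ G {x y} → x < y → entry G x y ≡ G (suc x) (suc y)
entry-< G {x} {y} x<y with x <ᵇ y | ℕP.<ᵇ-reflects-< x y
... | true  | _       = refl
... | false | ofⁿ x≮y = ⊥-elim (x≮y x<y)

entry-> : ∀ G {x y} → y < x → entry G x y ≡ G (suc y) (suc x)
entry-> G {x} {y} y<x with x <ᵇ y | ℕP.<ᵇ-reflects-< x y
... | true  | ofʸ x<y = ⊥-elim (ℕP.<-asym x<y y<x)
... | false | _       = refl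

entry-comm : ∀ G x y → entry G x y ≡ entry G y x
entry-comm G x y with ℕP.<-cmp x y
... | tri< x<y _ _  = trans (entry-< G x<y) (sym (entry-> G x<y))
... | tri≈ _ refl _ = refl
... | tri> _ _ y<x  = trans (entry-> G y<x) (sym (entry-< G y<x))

pairSum : ℕ → (ℕ → ℕ) → Compat → ℚ
pairSum N q C = sumBelow N (λ x → summand C x (q x))

Csum-toPairing : ∀ {N q} (q-pairs : IsPairing N q) C → Csum (toPairing q-pairs) C ≡ pairSum N q C
Csum-toPairing {N} q-pairs C =
  listSum-tabulate N (λ i → i) _ _ (λ i → cong (summand C (toℕ i)) (FP.toℕ-fromℕ< _))

pairSum-cong : ∀ N {q q′} C → (∀ x → x < N → q x ≡ q′ x) → pairSum N q C ≡ pairSum N q′ C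
pairSum-cong N C q≗q′ = sumBelow-cong N λ x x<N → cong (summand C x) (q≗q′ x x<N)

_⊖_ : Compat → Compat → Compat
(C ⊖ C′) i j = C i j - C′ i j

summandAt : ∀ {N} → Pairing N → Compat → Fin N → ℚ
summandAt S C i = if lbl i <ᵇ lbl (p S i) then C (lbl i) (lbl (p S i)) else 0ℚ

Csum-⊖ : ∀ {N} (S : Pairing N) C C′ → Csum S (C ⊖ C′) ≡ Csum S C - Csum S C′
Csum-⊖ {N} S C C′ =
  trans (listSum-cong (allFin N) λ {i} _ → if-− (lbl i <ᵇ lbl (p S i)))
        (listSum-− (allFin N) (summandAt S C) (summandAt S C′))
  where
  if-− : ∀ b {x y} → (if b then x - y else 0ℚ) ≡ (if b then x else 0ℚ) - (if b then y else 0ℚ)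
  if-− true  = refl
  if-− false = sym (ℚP.+-inverseʳ 0ℚ)

pairSum-⊖ : ∀ {N q} → IsPairing N q → ∀ C C′ → pairSum N q (C ⊖ C′) ≡ pairSum N q C - pairSum N q C′
pairSum-⊖ {N} {q} q-pairs C C′ = begin
  pairSum N q (C ⊖ C′)           ≡⟨ sym (Csum-toPairing q-pairs (C ⊖ C′)) ⟩
  Csum S (C ⊖ C′)                ≡⟨ Csum-⊖ S C C′ ⟩
  Csum S C - Csum S C′           ≡⟨ cong₂ _-_ (Csum-toPairing q-pairs C) (Csum-toPairing q-pairs C′) ⟩
  pairSum N q C - pairSum N q C′ ∎
  where
  open ≡-Reasoning
  S : Pairing N
  S = toPairing q-pairs

module Exchange {N q a b} (q-pairs : IsPairing N q) (a≢b : a ≢ b) (b≢qa : b ≢ q a) where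

  private
    τ : ℕ → ℕ
    τ = transpose a b

    q′ : ℕ → ℕ
    q′ = conjugateBy a b q

    a≢qa : a ≢ q a
    a≢qa = ≢-sym (fixfree q-pairs a)

    b≢qb : b ≢ q b
    b≢qb = ≢-sym (fixfree q-pairs b)

    a≢qb : a ≢ q b
    a≢qb a≡qb = b≢qa (trans (sym (involutive q-pairs b)) (cong q (sym a≡qb)))

    qa≢qb : q a ≢ q b
    qa≢qb qa≡qb = a≢b (trans (sym (involutive q-pairs a)) (trans (cong q qa≡qb) (involutive q-pairs b)))

    q≢a : ∀ {x} → x ≢ q a → q x ≢ a
    q≢a x≢qa qx≡a = x≢qa (trans (sym (involutive q-pairs _)) (cong q qx≡a))

    q≢b : ∀ {x} → x ≢ q b → q x ≢ b
    q≢b x≢qb qx≡b = x≢qb (trans (sym (involutive q-pairs _)) (cong q qx≡b))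

    q′-a : q′ a ≡ q b
    q′-a = trans (cong (τ ∘ q) (transpose-matchˡ a b)) (transpose-other a b (≢-sym a≢qb) (≢-sym b≢qb))

    q′-b : q′ b ≡ q a
    q′-b = trans (cong (τ ∘ q) (transpose-matchʳ a b)) (transpose-other a b (≢-sym a≢qa) (≢-sym b≢qa))

    q′-qa : q′ (q a) ≡ b
    q′-qa = begin
      τ (q (τ (q a))) ≡⟨ cong (τ ∘ q) (transpose-other a b (≢-sym a≢qa) (≢-sym b≢qa)) ⟩
      τ (q (q a))     ≡⟨ cong τ (involutive q-pairs a) ⟩
      τ a             ≡⟨ transpose-matchˡ a b ⟩
      b               ∎
      where open ≡-Reasoning

    q′-qb : q′ (q b) ≡ a
    q′-qb = begin
      τ (q (τ (q b))) ≡⟨ cong (τ ∘ q) (transpose-other a b (≢-sym a≢qb) (≢-sym b≢qb)) ⟩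
      τ (q (q b))     ≡⟨ cong τ (involutive q-pairs b) ⟩
      τ b             ≡⟨ transpose-matchʳ a b ⟩
      a               ∎
      where open ≡-Reasoning

    points : List ℕ
    points = a ∷ q a ∷ b ∷ q b ∷ []

    points-unique : Unique points
    points-unique = (a≢qa ∷ a≢b ∷ a≢qb ∷ [])
                  ∷ (≢-sym b≢qa ∷ qa≢qb ∷ [])
                  ∷ (b≢qb ∷ [])
                  ∷ []
                  ∷ []

    q′-other : ∀ x → x ∉ points → q′ x ≡ q x
    q′-other x x∉ = trans (cong (τ ∘ q) (transpose-other a b x≢a x≢b)) (transpose-other a b (q≢a x≢qa) (q≢b x≢qb))
      where
      x≢a : x ≢ a
      x≢a e = x∉ (here e)
      x≢qa : x ≢ q a
      x≢qa e = x∉ (there (here e))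
      x≢b : x ≢ b
      x≢b e = x∉ (there (there (here e)))
      x≢qb : x ≢ q b
      x≢qb e = x∉ (there (there (there (here e))))

  pairSum-exchange : ∀ C → a < N → b < N →
    pairSum N q′ C ≡ pairSum N q C - (entry C a (q a) + entry C b (q b)) + (entry C a (q b) + entry C b (q a))
  pairSum-exchange C a<N b<N = begin
    pairSum N q′ C
      ≡⟨ sumBelow-agreeOff N F G points-unique points<N (λ x x∉ → cong (summand C x) (q′-other x x∉)) ⟩
    pairSum N q C - listSum points G + listSum points F
      ≡⟨ cong₂ (λ s t → pairSum N q C - s + t) old new ⟩
    pairSum N q C - (entry C a (q a) + entry C b (q b)) + (entry C a (q b) + entry C b (q a))
      ∎
    where
    open ≡-Reasoning
    F G : ℕ → ℚ
    F x = summand C x (q′ x)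
    G x = summand C x (q x)
    points<N : All (_< N) points
    points<N = a<N ∷ bounded q-pairs a<N ∷ b<N ∷ bounded q-pairs b<N ∷ []
    old : listSum points G ≡ entry C a (q a) + entry C b (q b)
    old = begin
      G a + (summand C (q a) (q (q a)) + (G b + (summand C (q b) (q (q b)) + 0ℚ)))
        ≡⟨ cong₂ (λ s t → G a + (summand C (q a) s + (G b + (summand C (q b) t + 0ℚ))))
                 (involutive q-pairs a) (involutive q-pairs b) ⟩
      G a + (summand C (q a) a + (G b + (summand C (q b) b + 0ℚ)))
        ≡⟨ solve 4 (λ w x y z → w :+ (x :+ (y :+ (z :+ con 0ℚ))) := (w :+ x) :+ (y :+ z)) refl
             (G a) (summand C (q a) a) (G b) (summand C (q b) b) ⟩
      (G a + summand C (q a) a) + (G b + summand C (q b) b)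
        ≡⟨ cong₂ _+_ (summand-pair C a≢qa) (summand-pair C b≢qb) ⟩
      entry C a (q a) + entry C b (q b)
        ∎
    new : listSum points F ≡ entry C a (q b) + entry C b (q a)
    new = begin
      F a + (F (q a) + (F b + (F (q b) + 0ℚ)))
        ≡⟨ cong₂ _+_ (cong (summand C a) q′-a) (cong₂ _+_ (cong (summand C (q a)) q′-qa)
             (cong₂ _+_ (cong (summand C b) q′-b) (cong (λ s → summand C (q b) s + 0ℚ) q′-qb))) ⟩
      summand C a (q b) + (summand C (q a) b + (summand C b (q a) + (summand C (q b) a + 0ℚ)))
        ≡⟨ solve 4 (λ w x y z → w :+ (x :+ (y :+ (z :+ con 0ℚ))) := (w :+ z) :+ (y :+ x)) refl
             (summand C a (q b)) (summand C (q a) b) (summand C b (q a)) (summand C (q b) a) ⟩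
      (summand C a (q b) + summand C (q b) a) + (summand C b (q a) + summand C (q a) b)
        ≡⟨ cong₂ _+_ (summand-pair C a≢qb) (summand-pair C b≢qa) ⟩
      entry C a (q b) + entry C b (q a)
        ∎

  exchange-balanced : ∀ C → a < N → b < N → pairSum N q′ C ≡ pairSum N q C →
                      entry C a (q b) + entry C b (q a) ≡ entry C a (q a) + entry C b (q b)
  exchange-balanced C a<N b<N same = begin
    new                ≡⟨ solve 3 (λ S X Y → Y := (S :- X :+ Y) :- S :+ X) refl S old new ⟩
    S - old + new - S + old ≡⟨ cong (λ s → s - S + old) (trans (sym (pairSum-exchange C a<N b<N)) same) ⟩
    S - S + old        ≡⟨ solve 2 (λ S X → S :- S :+ X := X) refl S old ⟩
    old                ∎
    where
    open ≡-Reasoning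
    S old new : ℚ
    S   = pairSum N q C
    old = entry C a (q a) + entry C b (q b)
    new = entry C a (q b) + entry C b (q a)

sumForm : (ℕ → ℚ) → Compat
sumForm α i j = α (ℕ.pred i) + α (ℕ.pred j)

entry-sumForm : ∀ α x y → entry (sumForm α) x y ≡ α x + α y
entry-sumForm α x y with x <ᵇ y
... | true  = refl
... | false = ℚP.+-comm (α y) (α x)

pairSum-adjacent-sumForm : ∀ k α → pairSum (twice k) adjacent (sumForm α) ≡ sumBelow (twice k) α
pairSum-adjacent-sumForm zero    α = refl
pairSum-adjacent-sumForm (suc k) α = begin
  (α 0 + α 1) + (0ℚ + pairSum (twice k) adjacent (sumForm (α ∘ suc ∘ suc)))
    ≡⟨ cong (λ s → (α 0 + α 1) + (0ℚ + s)) (pairSum-adjacent-sumForm k (α ∘ suc ∘ suc)) ⟩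
  (α 0 + α 1) + (0ℚ + sumBelow (twice k) (α ∘ suc ∘ suc))
    ≡⟨ solve 3 (λ x y s → (x :+ y) :+ (con 0ℚ :+ s) := x :+ (y :+ s)) refl (α 0) (α 1) _ ⟩
  α 0 + (α 1 + sumBelow (twice k) (α ∘ suc ∘ suc))
    ∎
  where open ≡-Reasoning

pairSum-conjugate-sumForm : ∀ {N q} α t → IsPairing N q →
                            pairSum N (conjugate N t q) (sumForm α) ≡ pairSum N q (sumForm α)
pairSum-conjugate-sumForm {N} {q} α (a , b) q-pairs with a <? N ×-dec b <? N
... | no  _ = refl
... | yes (a<N , b<N) with a ≟ b
...   | yes refl = pairSum-cong N (sumForm α) λ x _ → conjugateBy-self a q x
...   | no a≢b with b ≟ q a
...     | yes refl = pairSum-cong N (sumForm α) λ x _ → conjugateBy-partner {q} (involutive q-pairs) a x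
...     | no b≢qa = begin
  pairSum N (conjugateBy a b q) (sumForm α)
    ≡⟨ pairSum-exchange (sumForm α) a<N b<N ⟩
  S - (entry′ a (q a) + entry′ b (q b)) + (entry′ a (q b) + entry′ b (q a))
    ≡⟨ cong₂ (λ s t → S - s + t) (cong₂ _+_ (entry-sumForm α a (q a)) (entry-sumForm α b (q b)))
                                 (cong₂ _+_ (entry-sumForm α a (q b)) (entry-sumForm α b (q a))) ⟩
  S - ((α a + α (q a)) + (α b + α (q b))) + ((α a + α (q b)) + (α b + α (q a)))
    ≡⟨ solve 5 (λ S x qx y qy → S :- ((x :+ qx) :+ (y :+ qy)) :+ ((x :+ qy) :+ (y :+ qx)) := S)
             refl S (α a) (α (q a)) (α b) (α (q b)) ⟩
  S ∎
  where
  open ≡-Reasoning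
  open Exchange q-pairs a≢b b≢qa
  S : ℚ
  S = pairSum N q (sumForm α)
  entry′ : ℕ → ℕ → ℚ
  entry′ = entry (sumForm α)

pairSum-sumForm : ∀ k ts α → pairSum (twice k) (pairingOf (twice k) ts) (sumForm α) ≡ sumBelow (twice k) α
pairSum-sumForm k []       α = pairSum-adjacent-sumForm k α
pairSum-sumForm k (t ∷ ts) α =
  trans (pairSum-conjugate-sumForm α t (pairingOf-isPairing k ts)) (pairSum-sumForm k ts α)

shift₂ : Compat → Compat
shift₂ G i j = G (suc (suc i)) (suc (suc j))

pairSum-adjacent-suc : ∀ k G → pairSum (twice (suc k)) adjacent G ≡ G 1 2 + pairSum (twice k) adjacent (shift₂ G)
pairSum-adjacent-suc k G = cong (G 1 2 +_) (ℚP.+-identityˡ _)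

pairSum-adjacent-constant : ∀ k G w → (∀ j → j < k → G (suc (twice j)) (suc (suc (twice j))) ≡ w) →
                            pairSum (twice k) adjacent G ≡ k ×ℚ w
pairSum-adjacent-constant zero    G w G≡w = refl
pairSum-adjacent-constant (suc k) G w G≡w =
  trans (pairSum-adjacent-suc k G)
        (cong₂ _+_ (G≡w 0 z<s) (pairSum-adjacent-constant k (shift₂ G) w λ j j<k → G≡w (suc j) (s<s j<k)))

-- The observed family and the constancy of the residual compatibilities

RowOneZero : Compat → Set
RowOneZero G = ∀ y → G 1 (suc (suc y)) ≡ 0ℚ

entry-rootˡ : ∀ G → RowOneZero G → ∀ {y} → y ≢ 0 → entry G 0 y ≡ 0ℚ
entry-rootˡ G G₁≡0 {zero}  y≢0 = ⊥-elim (y≢0 refl)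
entry-rootˡ G G₁≡0 {suc y} _   = G₁≡0 y

entry-rootʳ : ∀ G → RowOneZero G → ∀ {y} → y ≢ 0 → entry G y 0 ≡ 0ℚ
entry-rootʳ G G₁≡0 {y} y≢0 = trans (entry-comm G y 0) (entry-rootˡ G G₁≡0 y≢0)

-- The exchange identity in which both entries at vertex 0 vanish.
rerouting : ∀ {N q x v} G → RowOneZero G → IsPairing N q → x < N → v < N → x ≢ v → q x ≡ 0 → v ≢ 0 →
            pairSum N (conjugateBy x v q) G ≡ pairSum N q G → entry G x (q v) ≡ entry G v (q v)
rerouting {N} {q} {x} {v} G G₁≡0 q-pairs x<N v<N x≢v qx≡0 v≢0 same = begin
  entry G x (q v)                   ≡⟨ sym (ℚP.+-identityʳ _) ⟩
  entry G x (q v) + 0ℚ              ≡⟨ cong (entry G x (q v) +_) (sym (entry-rootʳ G G₁≡0 v≢0)) ⟩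
  entry G x (q v) + entry G v 0     ≡⟨ subst (λ z → entry G x (q v) + entry G v z ≡ entry G x z + entry G v (q v))
                                             qx≡0 (exchange-balanced G x<N v<N same) ⟩
  entry G x 0 + entry G v (q v)     ≡⟨ cong (_+ entry G v (q v)) (entry-rootʳ G G₁≡0 x≢0) ⟩
  0ℚ + entry G v (q v)              ≡⟨ ℚP.+-identityˡ _ ⟩
  entry G v (q v)                   ∎
  where
  open ≡-Reasoning
  open Exchange q-pairs x≢v (λ v≡qx → v≢0 (trans v≡qx qx≡0))
  x≢0 : x ≢ 0
  x≢0 x≡0 = fixfree q-pairs x (trans qx≡0 (sym x≡0))

top newLow newHigh : ℕ → ℕ
top m     = suc (suc (suc (twice m)))
newLow m  = twice (suc (suc m))
newHigh m = suc (newLow m)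

reroot : ℕ → List (ℕ × ℕ)
reroot (suc zero) = []
reroot x          = (1 , x) ∷ []

crossings : ℕ → ℕ → List (List (ℕ × ℕ))
crossings m zero    = []
crossings m (suc x) = ((suc x , newHigh m) ∷ reroot (suc x)) ∷ ((suc x , newLow m) ∷ reroot (suc x)) ∷ crossings m x

-- A list ts of transpositions stands for the pairing pairingOf N ts.  Stage 0 pairs vertex 0
-- with 1, 2, 3 in turn.  Stage m + 1 adds the adjacent pair {u, v} = {2m+4, 2m+5} through
-- (3 u)·adjacent, and for each earlier vertex x ≥ 1 exchanges x with v and with u in the
-- pairing where x is the partner of 0; each new pairing determines one new entry.
family : ℕ → List (List (ℕ × ℕ))
family zero    = reroot 1 ∷ reroot 2 ∷ reroot 3 ∷ []
family (suc m) = family m ++ ((3 , newLow m) ∷ []) ∷ crossings m (top m)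

crossings-∈ : ∀ m {r x} → 1 ≤ x → x ≤ r →
              ((x , newHigh m) ∷ reroot x) ∈ crossings m r × ((x , newLow m) ∷ reroot x) ∈ crossings m r
crossings-∈ m {zero}  {suc _} _ ()
crossings-∈ m {suc r} 1≤x x≤1+r with ℕP.m≤n⇒m<n∨m≡n x≤1+r
... | inj₂ refl      = here refl , there (here refl)
... | inj₁ (s≤s x≤r) = Product.map (there ∘ there) (there ∘ there) (crossings-∈ m 1≤x x≤r)

family-mono : ∀ {m n} → m ≤ n → ∀ {ts} → ts ∈ family m → ts ∈ family n
family-mono {n = zero}  z≤n    = λ ts∈ → ts∈
family-mono {n = suc n} m≤1+n with ℕP.m≤n⇒m<n∨m≡n m≤1+n
... | inj₂ refl      = λ ts∈ → ts∈
... | inj₁ (s≤s m≤n) = ∈-++⁺ˡ ∘ family-mono m≤n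

reroot-∈ : ∀ m {x} → 1 ≤ x → x ≤ top m → reroot x ∈ family m
reroot-∈ zero    {1} _ _ = here refl
reroot-∈ zero    {2} _ _ = there (here refl)
reroot-∈ zero    {3} _ _ = there (there (here refl))
reroot-∈ zero    {suc (suc (suc (suc _)))} _ (s≤s (s≤s (s≤s ())))
reroot-∈ (suc m) {x} 1≤x x≤top with ℕP.m≤n⇒m<n∨m≡n x≤top
... | inj₂ refl = ∈-++⁺ʳ (family m) (there (proj₁ (crossings-∈ m {top m} ℕP.≤-refl (s≤s z≤n))))
... | inj₁ (s≤s x≤top′) with ℕP.m≤n⇒m<n∨m≡n x≤top′
...   | inj₂ refl         = ∈-++⁺ʳ (family m) (there (proj₂ (crossings-∈ m {top m} ℕP.≤-refl (s≤s z≤n))))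
...   | inj₁ (s≤s x≤top″) = ∈-++⁺ˡ (reroot-∈ m 1≤x x≤top″)

reroot-root : ∀ {N x} → 1 < N → x < N → 1 ≤ x → pairingOf N (reroot x) x ≡ 0
reroot-root {x = suc zero}    _   _   _ = refl
reroot-root {N} {x = suc (suc y)} 1<N x<N _ = begin
  conjugate N (1 , x) adjacent x ≡⟨ cong-app (conjugate-inRange adjacent 1<N x<N) x ⟩
  transpose 1 x (adjacent (transpose 1 x x)) ≡⟨ cong (transpose 1 x ∘ adjacent) (transpose-matchʳ 1 x) ⟩
  transpose 1 x 0                            ≡⟨ transpose-other 1 x (λ ()) (λ ()) ⟩
  0                                          ∎
  where
  open ≡-Reasoning
  x : ℕ
  x = suc (suc y)

reroot-far : ∀ {N x z} → 1 < N → x < N → 1 ≤ x → x < z → x < adjacent z → pairingOf N (reroot x) z ≡ adjacent z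
reroot-far {x = suc zero}    _   _   _ _   _     = refl
reroot-far {N} {x = suc (suc y)} {z} 1<N x<N _ x<z x<qz = begin
  conjugate N (1 , x) adjacent z             ≡⟨ cong-app (conjugate-inRange adjacent 1<N x<N) z ⟩
  transpose 1 x (adjacent (transpose 1 x z)) ≡⟨ cong (transpose 1 x ∘ adjacent) (transpose-other 1 x (far x<z) (ℕP.>⇒≢ x<z)) ⟩
  transpose 1 x (adjacent z)                 ≡⟨ transpose-other 1 x (far x<qz) (ℕP.>⇒≢ x<qz) ⟩
  adjacent z                                 ∎
  where
  open ≡-Reasoning
  x : ℕ
  x = suc (suc y)
  far : ∀ {w} → x < w → w ≢ 1
  far (s≤s (s≤s _)) ()

reroot-newPair : ∀ {N m x} → 1 < N → x < N → 1 ≤ x → x ≤ top m →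
                 pairingOf N (reroot x) (newLow m) ≡ newHigh m × pairingOf N (reroot x) (newHigh m) ≡ newLow m
reroot-newPair {m = m} {x} 1<N x<N 1≤x x≤top =
  trans (reroot-far 1<N x<N 1≤x x<u (subst (x <_) (sym u↦v) x<v)) u↦v ,
  trans (reroot-far 1<N x<N 1≤x x<v (subst (x <_) (sym v↦u) x<u)) v↦u
  where
  x<u : x < newLow m
  x<u = s≤s x≤top
  x<v : x < newHigh m
  x<v = ℕP.m<n⇒m<1+n x<u
  u↦v : adjacent (newLow m) ≡ newHigh m
  u↦v = adjacent-even (suc (suc m))
  v↦u : adjacent (newHigh m) ≡ newLow m
  v↦u = adjacent-odd (suc (suc m))

length-crossings : ∀ m r → length (crossings m r) ≡ twice r
length-crossings m zero    = refl
length-crossings m (suc r) = cong (suc ∘ suc) (length-crossings m r)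

length-family : ∀ m → length (family m) ≡ top m ℕ.* suc m
length-family zero    = refl
length-family (suc m) = begin
  length (family m ++ _)                          ≡⟨ LP.length-++ (family m) ⟩
  length (family m) ℕ.+ suc (length (crossings m (top m)))
    ≡⟨ cong₂ (λ x y → x ℕ.+ suc y) (length-family m) (length-crossings m (top m)) ⟩
  top m ℕ.* suc m ℕ.+ suc (twice (top m))          ≡⟨ arith m ⟩
  top (suc m) ℕ.* suc (suc m)                     ∎
  where
  open ≡-Reasoning
  arith : ∀ m → top m ℕ.* suc m ℕ.+ suc (twice (top m)) ≡ top (suc m) ℕ.* suc (suc m)
  arith m rewrite twice≡+ (top m) | twice≡+ m = solve-∀′ m
    where
    solve-∀′ : ∀ m → suc (suc (suc (m ℕ.+ m))) ℕ.* suc m ℕ.+ suc (suc (suc (suc (m ℕ.+ m))) ℕ.+ suc (suc (suc (m ℕ.+ m))))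
                   ≡ suc (suc (suc (suc (suc (m ℕ.+ m))))) ℕ.* suc (suc m)
    solve-∀′ = solve-∀

module Constancy (K : ℕ) (G : Compat) (G₁≡0 : RowOneZero G) (c : ℚ)
  (family-sum : ∀ {ts} → ts ∈ family K → pairSum (twice (suc (suc K))) (pairingOf (twice (suc (suc K))) ts) G ≡ c)
  where

  w : ℚ
  w = entry G 2 3

  private
    N : ℕ
    N = twice (suc (suc K))

    1<N : 1 < N
    1<N = s≤s (s≤s z≤n)

    3<N : 3 < N
    3<N = s≤s (s≤s (s≤s (s≤s z≤n)))

    top<N : ∀ {m} → m ≤ K → top m < N
    top<N m≤K = s≤s (s≤s (s≤s (s≤s (twice-mono-≤ m≤K))))

    newHigh<N : ∀ {m} → suc m ≤ K → newHigh m < N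
    newHigh<N m<K = twice-mono-≤ (s≤s (s≤s m<K))

    initial∈ : ∀ {ts} → ts ∈ family 0 → ts ∈ family K
    initial∈ = family-mono {n = K} z≤n

    adjacent-pairs : IsPairing N adjacent
    adjacent-pairs = adjacent-isPairing (suc (suc K))

    balanced : ∀ {a b ts} → a < N → b < N → ((a , b) ∷ ts) ∈ family K → ts ∈ family K →
               pairSum N (conjugateBy a b (pairingOf N ts)) G ≡ pairSum N (pairingOf N ts) G
    balanced a<N b<N t∷ts∈ ts∈ =
      trans (cong (λ q → pairSum N q G) (sym (conjugate-inRange _ a<N b<N)))
            (trans (family-sum t∷ts∈) (sym (family-sum ts∈)))

    new-edges : ∀ {m} → suc m ≤ K → ∀ {x} → 1 ≤ x → x ≤ top m →
                entry G x (newLow m) ≡ entry G (newLow m) (newHigh m) ×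
                entry G x (newHigh m) ≡ entry G (newLow m) (newHigh m)
    new-edges {m} m<K {x} 1≤x x≤top = low , high
      where
      open ≡-Reasoning
      u v : ℕ
      u = newLow m
      v = newHigh m
      x<N : x < N
      x<N = ℕP.≤-<-trans x≤top (top<N (ℕP.<⇒≤ m<K))
      v<N : v < N
      v<N = newHigh<N m<K
      u<N : u < N
      u<N = ℕP.<-trans (ℕP.n<1+n u) v<N
      x<v : x < v
      x<v = ℕP.m<n⇒m<1+n (s≤s x≤top)
      q : ℕ → ℕ
      q = pairingOf N (reroot x)
      q-pairs : IsPairing N q
      q-pairs = pairingOf-isPairing (suc (suc K)) (reroot x)
      qx≡0 : q x ≡ 0
      qx≡0 = reroot-root 1<N x<N 1≤x
      qu≡v : q u ≡ v
      qu≡v = proj₁ (reroot-newPair 1<N x<N 1≤x x≤top)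
      qv≡u : q v ≡ u
      qv≡u = proj₂ (reroot-newPair 1<N x<N 1≤x x≤top)
      crossing∈ : ∀ {ts} → ts ∈ crossings m (top m) → ts ∈ family K
      crossing∈ ts∈ = family-mono m<K (∈-++⁺ʳ (family m) (there ts∈))
      reroot∈ : reroot x ∈ family K
      reroot∈ = family-mono (ℕP.<⇒≤ m<K) (reroot-∈ m 1≤x x≤top)
      low : entry G x u ≡ entry G u v
      low = begin
        entry G x u     ≡⟨ cong (entry G x) (sym qv≡u) ⟩
        entry G x (q v) ≡⟨ rerouting G G₁≡0 q-pairs x<N v<N (ℕP.<⇒≢ x<v) qx≡0 (λ ())
                             (balanced x<N v<N (crossing∈ (proj₁ (crossings-∈ m 1≤x x≤top))) reroot∈) ⟩
        entry G v (q v) ≡⟨ cong (entry G v) qv≡u ⟩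
        entry G v u     ≡⟨ entry-comm G v u ⟩
        entry G u v     ∎
      high : entry G x v ≡ entry G u v
      high = begin
        entry G x v     ≡⟨ cong (entry G x) (sym qu≡v) ⟩
        entry G x (q u) ≡⟨ rerouting G G₁≡0 q-pairs x<N u<N (ℕP.<⇒≢ (s≤s x≤top)) qx≡0 (λ ())
                             (balanced x<N u<N (crossing∈ (proj₂ (crossings-∈ m 1≤x x≤top))) reroot∈) ⟩
        entry G u (q u) ≡⟨ cong (entry G u) qu≡v ⟩
        entry G u v     ∎

    new-pair : ∀ {m} → suc m ≤ K → entry G (newLow m) (newHigh m) ≡ w
    new-pair {m} m<K = ∙-cancelʳ t t w (begin
      t + t                                     ≡⟨ cong₂ _+_ (sym (proj₂ (new-edges m<K {3} (s≤s z≤n) 3≤top)))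
                                                             (sym (trans (entry-comm G u 2) (proj₁ (new-edges m<K {2} (s≤s z≤n) 2≤top)))) ⟩
      entry G 3 v + entry G u 2                 ≡⟨ cong (λ z → entry G 3 z + entry G u 2) (sym (adjacent-even (suc (suc m)))) ⟩
      entry G 3 (adjacent u) + entry G u 2      ≡⟨ exchange-balanced G 3<N u<N (balanced 3<N u<N low∈ (initial∈ (here refl))) ⟩
      entry G 3 2 + entry G u (adjacent u)      ≡⟨ cong₂ (λ z z′ → z + entry G u z′) (entry-comm G 3 2) (adjacent-even (suc (suc m))) ⟩
      w + t                                     ∎)
      where
      open ≡-Reasoning
      u v : ℕ
      u = newLow m
      v = newHigh m
      t : ℚ
      t = entry G u v
      u<N : u < N
      u<N = ℕP.<-trans (ℕP.n<1+n u) (newHigh<N m<K)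
      2≤top : 2 ≤ top m
      2≤top = s≤s (s≤s z≤n)
      3≤top : 3 ≤ top m
      3≤top = s≤s (s≤s (s≤s z≤n))
      low∈ : ((3 , u) ∷ []) ∈ family K
      low∈ = family-mono m<K (∈-++⁺ʳ (family m) (here refl))
      open Exchange {a = 3} {b = u} adjacent-pairs (λ ()) (λ ())

  constant : ∀ m → m ≤ K → ∀ {x y} → 1 ≤ x → x < y → y ≤ top m → entry G x y ≡ w
  constant zero _ {1} {2} _ _ _ = begin
    entry G 1 2 ≡⟨ rerouting G G₁≡0 adjacent-pairs 1<N 3<N (λ ()) refl (λ ())
                     (balanced 1<N 3<N (initial∈ (there (there (here refl)))) (initial∈ (here refl))) ⟩
    entry G 3 2 ≡⟨ entry-comm G 3 2 ⟩
    w           ∎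
    where open ≡-Reasoning
  constant zero _ {1} {3} _ _ _ =
    rerouting G G₁≡0 adjacent-pairs 1<N (s≤s (s≤s (s≤s z≤n))) (λ ()) refl (λ ())
      (balanced 1<N (s≤s (s≤s (s≤s z≤n))) (initial∈ (there (here refl))) (initial∈ (here refl)))
  constant zero _ {2} {3} _ _ _ = refl
  constant zero _ {1} {1} _ (s≤s ()) _
  constant zero _ {2} {1} _ (s≤s ()) _
  constant zero _ {2} {2} _ (s≤s (s≤s ())) _
  constant zero _ {suc (suc (suc _))} (s≤s _) (s≤s (s≤s (s≤s (s≤s _)))) (s≤s (s≤s (s≤s ())))
  constant zero _ {suc _} {suc (suc (suc (suc _)))} _ _ (s≤s (s≤s (s≤s ())))
  constant (suc m) m<K {x} {y} 1≤x x<y y≤top with ℕP.m≤n⇒m<n∨m≡n y≤top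
  ... | inj₂ refl with ℕP.m≤n⇒m<n∨m≡n (ℕP.≤-pred x<y)
  ...   | inj₂ refl      = new-pair m<K
  ...   | inj₁ (s≤s x≤top) = trans (proj₂ (new-edges m<K 1≤x x≤top)) (new-pair m<K)
  constant (suc m) m<K {x} {y} 1≤x x<y y≤top | inj₁ (s≤s y≤top′) with ℕP.m≤n⇒m<n∨m≡n y≤top′
  ... | inj₂ refl       = trans (proj₁ (new-edges m<K 1≤x (ℕP.≤-pred x<y))) (new-pair m<K)
  ... | inj₁ (s≤s y≤top″) = constant m (ℕP.<⇒≤ m<K) 1≤x x<y y≤top″

  edges-constant : ∀ {x y} → 1 ≤ x → x < y → y < N → G (suc x) (suc y) ≡ w
  edges-constant 1≤x x<y y<N = trans (sym (entry-< G x<y)) (constant K ℕP.≤-refl 1≤x x<y (ℕP.≤-pred y<N))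

  total-constant : c ≡ suc K ×ℚ w
  total-constant = begin
    c                                                   ≡⟨ sym (family-sum (initial∈ (here refl))) ⟩
    pairSum N adjacent G                                ≡⟨ pairSum-adjacent-suc (suc K) G ⟩
    G 1 2 + pairSum (twice (suc K)) adjacent (shift₂ G) ≡⟨ cong₂ _+_ (G₁≡0 0) (pairSum-adjacent-constant (suc K) (shift₂ G) w edge) ⟩
    0ℚ + suc K ×ℚ w                                     ≡⟨ ℚP.+-identityˡ _ ⟩
    suc K ×ℚ w                                          ∎
    where
    open ≡-Reasoning
    edge : ∀ j → j < suc K → shift₂ G (suc (twice j)) (suc (suc (twice j))) ≡ w
    edge j j<1+K = edges-constant (s≤s z≤n) ℕP.≤-refl (s≤s (s≤s (s≤s (s≤s (twice-mono-≤ (ℕP.≤-pred j<1+K))))))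

-- Upper bound

sum1-⊖ : ∀ N C C′ → sum1 N (C ⊖ C′) ≡ sum1 N C - sum1 N C′
sum1-⊖ N C C′ = listSum-− (upTo (N ∸ 1)) (λ k → C 1 (suc (suc k))) (λ k → C′ 1 (suc (suc k)))

Ctilde-⊖ : ∀ N C C′ i j → Ctilde N (C ⊖ C′) (suc (suc i)) (suc (suc j)) ≡
                          Ctilde N C (suc (suc i)) (suc (suc j)) - Ctilde N C′ (suc (suc i)) (suc (suc j))
Ctilde-⊖ N C C′ i j = trans (cong (λ s → (C ⊖ C′) I J - (C ⊖ C′) 1 I - (C ⊖ C′) 1 J + coef N * s) (sum1-⊖ N C C′))
  (solve 9 (λ a b c a′ b′ c′ κ s s′ → (a :- a′) :- (b :- b′) :- (c :- c′) :+ κ :* (s :- s′)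
                                     := (a :- b :- c :+ κ :* s) :- (a′ :- b′ :- c′ :+ κ :* s′))
     refl (C I J) (C 1 I) (C 1 J) (C′ I J) (C′ 1 I) (C′ 1 J) (coef N) (sum1 N C) (sum1 N C′))
  where
  I J : ℕ
  I = suc (suc i)
  J = suc (suc j)

Ctilde-rowOneZero : ∀ N C → (∀ x → C 1 x ≡ 0ℚ) → ∀ i j → Ctilde N C (suc (suc i)) (suc (suc j)) ≡ C (suc (suc i)) (suc (suc j))
Ctilde-rowOneZero N C C₁≡0 i j = begin
  C I J - C 1 I - C 1 J + coef N * sum1 N C ≡⟨ cong₂ (λ x y → C I J - x - y + coef N * sum1 N C) (C₁≡0 I) (C₁≡0 J) ⟩
  C I J - 0ℚ - 0ℚ + coef N * sum1 N C       ≡⟨ cong (λ s → C I J - 0ℚ - 0ℚ + coef N * s) sum1≡0 ⟩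
  C I J - 0ℚ - 0ℚ + coef N * 0ℚ             ≡⟨ solve 2 (λ c κ → c :- con 0ℚ :- con 0ℚ :+ κ :* con 0ℚ := c) refl (C I J) (coef N) ⟩
  C I J                                     ∎
  where
  open ≡-Reasoning
  I J : ℕ
  I = suc (suc i)
  J = suc (suc j)
  sum1≡0 : sum1 N C ≡ 0ℚ
  sum1≡0 = trans (listSum-cong (upTo (N ∸ 1)) λ {k} _ → C₁≡0 (suc (suc k))) (listSum-0 (upTo (N ∸ 1)))

×1-toℚᵘ : ∀ n → toℚᵘ (n ×ℚ 1ℚ) ℚᵘ.≃ mkℚᵘ (ℤ.+ n) 0
×1-toℚᵘ zero    = *≡* refl
×1-toℚᵘ (suc n) = ℚᵘP.≃-trans (ℚP.toℚᵘ-homo-+ 1ℚ (n ×ℚ 1ℚ))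
  (ℚᵘP.≃-trans (ℚᵘP.+-congʳ ℚᵘ.1ℚᵘ (×1-toℚᵘ n))
    (*≡* (trans (ℤP.*-identityʳ _) (trans (cong (ℤ._+_ (ℤ.+ 1)) (ℤP.*-identityʳ (ℤ.+ n))) (sym (ℤP.*-identityʳ _))))))

coef-inverse : ∀ K → coef (twice (suc (suc K))) * (suc K ×ℚ 1ℚ) ≡ 1ℚ
coef-inverse K = ℚP.toℚᵘ-injective (ℚᵘP.≃-trans (ℚP.toℚᵘ-homo-* (coef (twice (suc (suc K)))) (suc K ×ℚ 1ℚ))
  (ℚᵘP.≃-trans (ℚᵘP.*-cong (ℚP.toℚᵘ-fromℚᵘ (mkℚᵘ (ℤ.+ 2) (suc (twice K)))) (×1-toℚᵘ (suc K)))
    (*≡* (cong ℤ.+_ (trans (arith K) (cong (λ z → suc (suc (z ℕ.* 1 ℕ.+ 0 ℕ.* suc (suc (z ℕ.* 1))))) (sym (twice≡+ K))))))))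
  where
  arith : ∀ K → suc ((K ℕ.+ 1 ℕ.* suc K) ℕ.* 1) ≡ suc (suc ((K ℕ.+ K) ℕ.* 1 ℕ.+ 0 ℕ.* suc (suc ((K ℕ.+ K) ℕ.* 1))))
  arith = solve-∀

multiple-cancel : ∀ κ m w s → κ * m ≡ 1ℚ → - s ≡ m * w → w + κ * s ≡ 0ℚ
multiple-cancel κ m w s κm≡1 -s≡mw = begin
  w + κ * s            ≡⟨ solve 3 (λ κ w s → w :+ κ :* s := w :- κ :* (:- s)) refl κ w s ⟩
  w - κ * (- s)        ≡⟨ cong (λ x → w - κ * x) -s≡mw ⟩
  w - κ * (m * w)      ≡⟨ solve 3 (λ κ m w → w :- κ :* (m :* w) := w :- (κ :* m) :* w) refl κ m w ⟩
  w - (κ * m) * w      ≡⟨ cong (λ x → w - x * w) κm≡1 ⟩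
  w - 1ℚ * w           ≡⟨ solve 1 (λ w → w :- con 1ℚ :* w := con 0ℚ) refl w ⟩
  0ℚ                   ∎
  where open ≡-Reasoning

target-twice : ∀ K → target (twice (suc (suc K))) ≡ top K ℕ.* suc K
target-twice K = begin
  (top K ℕ.* suc (suc (twice K))) / 2 ≡⟨ cong (λ z → (top K ℕ.* z) / 2) (trans (cong (suc ∘ suc) (twice≡+ K)) (arith K)) ⟩
  (top K ℕ.* (suc K ℕ.* 2)) / 2       ≡⟨ cong (_/ 2) (sym (ℕP.*-assoc (top K) (suc K) 2)) ⟩
  (top K ℕ.* suc K ℕ.* 2) / 2         ≡⟨ m*n/n≡m (top K ℕ.* suc K) 2 ⟩
  top K ℕ.* suc K                     ∎
  where
  open ≡-Reasoning
  arith : ∀ K → suc (suc (K ℕ.+ K)) ≡ suc K ℕ.* 2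
  arith = solve-∀

module UpperBound (K : ℕ) where

  private
    N : ℕ
    N = twice (suc (suc K))

    pairingOf-pairs : ∀ ts → IsPairing N (pairingOf N ts)
    pairingOf-pairs = pairingOf-isPairing (suc (suc K))

  witnesses : List (Pairing N)
  witnesses = map (toPairing ∘ pairingOf-pairs) (family K)

  length-witnesses : length witnesses ≡ target N
  length-witnesses = trans (LP.length-map _ (family K)) (trans (length-family K) (sym (target-twice K)))

  Ctilde-vanishes : ∀ D → (∀ {ts} → ts ∈ family K → pairSum N (pairingOf N ts) D ≡ 0ℚ) →
                    ∀ {i j} → i < j → suc (suc j) ≤ N → Ctilde N D (suc (suc i)) (suc (suc j)) ≡ 0ℚ
  Ctilde-vanishes D sums {i} {j} i<j j<N = begin
    D I J - D 1 I - D 1 J + κ * sum1 N D ≡⟨ cong (λ s → D I J - D 1 I - D 1 J + κ * s) sum1≡Σα ⟩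
    D I J - D 1 I - D 1 J + κ * Σα      ≡⟨ cong (_+ κ * Σα) (solve 3 (λ d a b → d :- a :- b := d :- (a :+ b)) refl (D I J) (D 1 I) (D 1 J)) ⟩
    G I J + κ * Σα                      ≡⟨ cong (_+ κ * Σα) (edges-constant (s≤s z≤n) (s≤s i<j) j<N) ⟩
    w + κ * Σα                          ≡⟨ multiple-cancel κ (suc K ×ℚ 1ℚ) w Σα (coef-inverse K) -Σα≡mw ⟩
    0ℚ                                  ∎
    where
    open ≡-Reasoning
    I J : ℕ
    I = suc (suc i)
    J = suc (suc j)
    κ : ℚ
    κ = coef N
    α : ℕ → ℚ
    α zero    = 0ℚ
    α (suc x) = D 1 (suc (suc x))
    Σα : ℚ
    Σα = sumBelow N α
    G : Compat
    G = D ⊖ sumForm α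
    G₁≡0 : RowOneZero G
    G₁≡0 y = solve 1 (λ d → d :- (con 0ℚ :+ d) := con 0ℚ) refl (D 1 (suc (suc y)))
    G-sums : ∀ {ts} → ts ∈ family K → pairSum N (pairingOf N ts) G ≡ - Σα
    G-sums {ts} ts∈ = begin
      pairSum N (pairingOf N ts) G
        ≡⟨ pairSum-⊖ (pairingOf-pairs ts) D (sumForm α) ⟩
      pairSum N (pairingOf N ts) D - pairSum N (pairingOf N ts) (sumForm α)
        ≡⟨ cong₂ _-_ (sums ts∈) (pairSum-sumForm (suc (suc K)) ts α) ⟩
      0ℚ - Σα
        ≡⟨ ℚP.+-identityˡ (- Σα) ⟩
      - Σα
        ∎
    open Constancy K G G₁≡0 (- Σα) G-sums using (w; edges-constant; total-constant)
    sum1≡Σα : sum1 N D ≡ Σα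
    sum1≡Σα = trans (listSum-applyUpTo (N ∸ 1) (λ k → k) (λ k → D 1 (suc (suc k)))) (sym (ℚP.+-identityˡ _))
    -Σα≡mw : - Σα ≡ (suc K ×ℚ 1ℚ) * w
    -Σα≡mw = trans total-constant (sym (trans (×-assoc-* (suc K) 1ℚ w) (cong (suc K ×ℚ_) (ℚP.*-identityˡ w))))

  determines : Determines N witnesses
  determines C C′ same (suc zero)    j             _ _               _   = refl
  determines C C′ same (suc (suc i)) (suc (suc j)) _ (s<s (s<s i<j)) j≤N =
    x∙y⁻¹≈ε⇒x≈y _ _ (trans (sym (Ctilde-⊖ N C C′ i j)) (Ctilde-vanishes (C ⊖ C′) sums i<j j≤N))
    where
    sums : ∀ {ts} → ts ∈ family K → pairSum N (pairingOf N ts) (C ⊖ C′) ≡ 0ℚ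
    sums {ts} ts∈ = trans (pairSum-⊖ (pairingOf-pairs ts) C C′) (x≈y⇒x∙y⁻¹≈ε (begin
      pairSum N (pairingOf N ts) C  ≡⟨ sym (Csum-toPairing (pairingOf-pairs ts) C) ⟩
      Csum S C                      ≡⟨ same (∈-map⁺ (toPairing ∘ pairingOf-pairs) ts∈) ⟩
      Csum S C′                     ≡⟨ Csum-toPairing (pairingOf-pairs ts) C′ ⟩
      pairSum N (pairingOf N ts) C′ ∎))
      where
      open ≡-Reasoning
      S : Pairing N
      S = toPairing (pairingOf-pairs ts)

-- Lower bound

record LinearFunctional (A : Set) : Set where
  field
    apply      : (A → ℚ) → ℚ
    apply-cong : ∀ {u v} → (∀ k → u k ≡ v k) → apply u ≡ apply v
    apply-+    : ∀ u v → apply (λ k → u k + v k) ≡ apply u + apply v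
    apply-*    : ∀ r u → apply (λ k → r * u k) ≡ r * apply u
open LinearFunctional

apply-zero : ∀ {A} (f : LinearFunctional A) → apply f (λ _ → 0ℚ) ≡ 0ℚ
apply-zero f = begin
  apply f (λ _ → 0ℚ)       ≡⟨ apply-cong f (λ _ → sym (ℚP.*-zeroˡ 0ℚ)) ⟩
  apply f (λ _ → 0ℚ * 0ℚ)  ≡⟨ apply-* f 0ℚ (λ _ → 0ℚ) ⟩
  0ℚ * apply f (λ _ → 0ℚ)  ≡⟨ ℚP.*-zeroˡ (apply f (λ _ → 0ℚ)) ⟩
  0ℚ                       ∎
  where open ≡-Reasoning

All-removeAny⁻ : ∀ {A : Set} {P Q : A → Set} {xs} (p : Any Q xs) → All P (xs Any.─ p) → P (Any.lookup p) → All P xs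
All-removeAny⁻ (here _)  Pxs          Pp = Pp ∷ Pxs
All-removeAny⁻ (there p) (Px ∷ Pxs) Pp = Px ∷ All-removeAny⁻ p Pxs Pp

length-map-removeAt-< : ∀ {B C : Set} {h : B → C} (xs : List B) i {n} → length xs < suc n →
                        length (map h (removeAt xs i)) < n
length-map-removeAt-< {h = h} xs i {n} xs<1+n = subst (_< n) (sym (LP.length-map h (removeAt xs i)))
  (ℕP.≤-pred (subst (_< suc n) (LP.length-removeAt′ xs i) xs<1+n))

module Kernel {A : Set} (_≟ᴬ_ : DecidableEquality A) where

  basis : A → A → ℚ
  basis k z = if does (z ≟ᴬ k) then 1ℚ else 0ℚ

  basis-same : ∀ k → basis k k ≡ 1ℚ
  basis-same k rewrite dec-true (k ≟ᴬ k) refl = refl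

  basis-other : ∀ {k z} → z ≢ k → basis k z ≡ 0ℚ
  basis-other {k} {z} z≢k rewrite dec-false (z ≟ᴬ k) z≢k = refl

  -- One step of Gaussian elimination: projection onto ker f along basis k.
  module Pivot (f : LinearFunctional A) (k : A) (f[k]≢0 : apply f (basis k) ≢ 0ℚ) where

    private
      instance
        f[k]-nonZero : ℚ.NonZero (apply f (basis k))
        f[k]-nonZero = ℚ.≢-nonZero f[k]≢0

    ratio : (A → ℚ) → ℚ
    ratio u = apply f u * 1/ apply f (basis k)

    project : (A → ℚ) → A → ℚ
    project u z = u z + (- ratio u) * basis k z

    apply-project : ∀ u → apply f (project u) ≡ 0ℚ
    apply-project u = begin
      apply f (project u)                         ≡⟨ apply-+ f u _ ⟩
      a + apply f (λ z → (- ratio u) * basis k z) ≡⟨ cong (a +_) (apply-* f (- ratio u) (basis k)) ⟩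
      a + (- (a * i)) * d                         ≡⟨ solve 3 (λ a i d → a :+ (:- (a :* i)) :* d := a :- a :* (i :* d)) refl a i d ⟩
      a - a * (i * d)                             ≡⟨ cong (λ x → a - a * x) (ℚP.*-inverseˡ d) ⟩
      a - a * 1ℚ                                  ≡⟨ solve 1 (λ a → a :- a :* con 1ℚ := con 0ℚ) refl a ⟩
      0ℚ                                          ∎
      where
      open ≡-Reasoning
      a d i : ℚ
      a = apply f u
      d = apply f (basis k)
      i = 1/ d

    project-other : ∀ u {z} → z ≢ k → project u z ≡ u z
    project-other u {z} z≢k = begin
      u z + (- ratio u) * basis k z ≡⟨ cong (λ b → u z + (- ratio u) * b) (basis-other z≢k) ⟩
      u z + (- ratio u) * 0ℚ        ≡⟨ cong (u z +_) (ℚP.*-zeroʳ (- ratio u)) ⟩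
      u z + 0ℚ                      ≡⟨ ℚP.+-identityʳ _ ⟩
      u z                           ∎
      where open ≡-Reasoning

    project-cong : ∀ {u v} → (∀ z → u z ≡ v z) → ∀ z → project u z ≡ project v z
    project-cong u≗v z = cong₂ (λ x y → x + (- (y * 1/ apply f (basis k))) * basis k z) (u≗v z) (apply-cong f u≗v)

    project-+ : ∀ u v z → project (λ x → u x + v x) z ≡ project u z + project v z
    project-+ u v z = begin
      (u z + v z) + (- ((apply f (λ x → u x + v x)) * i)) * b
        ≡⟨ cong (λ y → (u z + v z) + (- (y * i)) * b) (apply-+ f u v) ⟩
      (u z + v z) + (- ((apply f u + apply f v) * i)) * b
        ≡⟨ solve 6 (λ x y p q i b → (x :+ y) :+ (:- ((p :+ q) :* i)) :* b := (x :+ (:- (p :* i)) :* b) :+ (y :+ (:- (q :* i)) :* b))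
             refl (u z) (v z) (apply f u) (apply f v) i b ⟩
      project u z + project v z
        ∎
      where
      open ≡-Reasoning
      i b : ℚ
      i = 1/ apply f (basis k)
      b = basis k z

    project-* : ∀ r u z → project (λ x → r * u x) z ≡ r * project u z
    project-* r u z = begin
      r * u z + (- (apply f (λ x → r * u x) * i)) * b ≡⟨ cong (λ y → r * u z + (- (y * i)) * b) (apply-* f r u) ⟩
      r * u z + (- ((r * apply f u) * i)) * b         ≡⟨ solve 5 (λ r x p i b → r :* x :+ (:- ((r :* p) :* i)) :* b := r :* (x :+ (:- (p :* i)) :* b))
                                                           refl r (u z) (apply f u) i b ⟩
      r * project u z                                 ∎
      where
      open ≡-Reasoning
      i b : ℚ
      i = 1/ apply f (basis k)
      b = basis k z

    restrict : LinearFunctional A → LinearFunctional A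
    restrict g = record
      { apply      = λ u → apply g (project u)
      ; apply-cong = λ u≗v → apply-cong g (project-cong u≗v)
      ; apply-+    = λ u v → trans (apply-cong g (project-+ u v)) (apply-+ g (project u) (project v))
      ; apply-*    = λ r u → trans (apply-cong g (project-* r u)) (apply-* g r (project u))
      }

  NontrivialSolution : List (LinearFunctional A) → List A → Set
  NontrivialSolution fs ks =
    Σ[ D ∈ (A → ℚ) ] All (λ g → apply g D ≡ 0ℚ) fs × (∀ z → z ∉ ks → D z ≡ 0ℚ) × (Σ[ k ∈ A ] k ∈ ks × D k ≢ 0ℚ)

  kernel : ∀ fs ks → Unique ks → length fs < length ks → NontrivialSolution fs ks
  kernel fs (k ∷ ks) (k∉ks ∷ ks-unique) fs<k∷ks with All.all? (λ g → apply g (basis k) ℚP.≟ 0ℚ) fs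
  ... | yes vanish =
    basis k , vanish , (λ z z∉ → basis-other λ z≡k → z∉ (here z≡k)) , k , here refl ,
    λ basis[k]≡0 → ℚP.1≢0 (trans (sym (basis-same k)) basis[k]≡0)
  ... | no ¬vanish with ¬All⇒Any¬ (λ g → apply g (basis k) ℚP.≟ 0ℚ) fs ¬vanish
  ...   | pivot with kernel (map (Pivot.restrict (Any.lookup pivot) k (lookup-result pivot)) (fs Any.─ pivot))
                            ks ks-unique (length-map-removeAt-< fs (Any.index pivot) fs<k∷ks)
  ...     | D , zeros , support , k′ , k′∈ks , D[k′]≢0 =
    project D , All-removeAny⁻ pivot (All.map⁻ zeros) (apply-project D) , support′ , k′ , there k′∈ks , nonzero
    where
    open Pivot (Any.lookup pivot) k (lookup-result pivot)
    support′ : ∀ z → z ∉ k ∷ ks → project D z ≡ 0ℚ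
    support′ z z∉ = trans (project-other D λ z≡k → z∉ (here z≡k)) (support z λ z∈ks → z∉ (there z∈ks))
    nonzero : project D k′ ≢ 0ℚ
    nonzero = D[k′]≢0 ∘ trans (sym (project-other D λ k′≡k → All.lookup k∉ks k′∈ks (sym k′≡k)))

Csum-functional : ∀ {N} → Pairing N → LinearFunctional (ℕ × ℕ)
Csum-functional {N} S = record
  { apply      = λ D → Csum S (curry D)
  ; apply-cong = λ u≗v → listSum-cong (allFin N) λ {i} _ → cong (if lbl i <ᵇ lbl (p S i) then_else 0ℚ) (u≗v _)
  ; apply-+    = λ u v → trans (listSum-cong (allFin N) λ {i} _ → if-+ (lbl i <ᵇ lbl (p S i)))
                               (listSum-+ (allFin N) (summandAt S (curry u)) (summandAt S (curry v)))
  ; apply-*    = λ r u → trans (listSum-cong (allFin N) λ {i} _ → if-* (lbl i <ᵇ lbl (p S i)) r)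
                               (listSum-* (allFin N) r (summandAt S (curry u)))
  }
  where
  if-+ : ∀ b {x y} → (if b then x + y else 0ℚ) ≡ (if b then x else 0ℚ) + (if b then y else 0ℚ)
  if-+ true  = refl
  if-+ false = refl
  if-* : ∀ b r {x} → (if b then r * x else 0ℚ) ≡ r * (if b then x else 0ℚ)
  if-* true  r = refl
  if-* false r = sym (ℚP.*-zeroʳ r)

column : ℕ → ℕ → List (ℕ × ℕ)
column t zero    = []
column t (suc m) = (suc (suc m) , t) ∷ column t m

column-∈ : ∀ {t m z} → z ∈ column t m → proj₂ z ≡ t × 2 ≤ proj₁ z × proj₁ z ≤ suc m
column-∈ {m = suc m} (here refl)  = refl , s≤s (s≤s z≤n) , ℕP.≤-refl
column-∈ {m = suc m} (there z∈) = Product.map₂ (Product.map₂ ℕP.m≤n⇒m≤1+n) (column-∈ z∈)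

column-unique : ∀ t m → Unique (column t m)
column-unique t zero    = []
column-unique t (suc m) =
  All.tabulate (λ z∈ eq → ℕP.<-irrefl (sym (cong proj₁ eq)) (s≤s (proj₂ (proj₂ (column-∈ z∈))))) ∷ column-unique t m

keys : ℕ → List (ℕ × ℕ)
keys zero    = []
keys (suc r) = keys r ++ column (suc (suc (suc r))) (suc r)

keys-∈ : ∀ {r z} → z ∈ keys r → 2 ≤ proj₁ z × proj₁ z < proj₂ z × proj₂ z ≤ suc (suc r)
keys-∈ {suc r} z∈ with ∈-++⁻ (keys r) z∈
... | inj₁ z∈keys   = Product.map₂ (Product.map₂ ℕP.m≤n⇒m≤1+n) (keys-∈ z∈keys)
... | inj₂ z∈column with column-∈ z∈column
...   | refl , 2≤i , i≤ = 2≤i , s≤s i≤ , ℕP.≤-refl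

keys-unique : ∀ r → Unique (keys r)
keys-unique zero    = []
keys-unique (suc r) = ++⁺ (keys-unique r) (column-unique _ (suc r)) λ (z∈keys , z∈column) →
  ℕP.<-irrefl (proj₁ (column-∈ z∈column)) (s≤s (proj₂ (proj₂ (keys-∈ z∈keys))))

length-keys : ∀ r → length (keys r) ℕ.* 2 ≡ r ℕ.* suc r
length-keys zero    = refl
length-keys (suc r) = begin
  length (keys r ++ column _ (suc r)) ℕ.* 2           ≡⟨ cong (ℕ._* 2) (trans (LP.length-++ (keys r)) (cong (length (keys r) ℕ.+_) (length-column (suc r)))) ⟩
  (length (keys r) ℕ.+ suc r) ℕ.* 2                   ≡⟨ ℕP.*-distribʳ-+ 2 (length (keys r)) (suc r) ⟩
  length (keys r) ℕ.* 2 ℕ.+ suc r ℕ.* 2               ≡⟨ cong (ℕ._+ suc r ℕ.* 2) (length-keys r) ⟩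
  r ℕ.* suc r ℕ.+ suc r ℕ.* 2                         ≡⟨ arith r ⟩
  suc r ℕ.* suc (suc r)                               ∎
  where
  open ≡-Reasoning
  length-column : ∀ m → length (column (suc (suc (suc r))) m) ≡ m
  length-column zero    = refl
  length-column (suc m) = cong suc (length-column m)
  arith : ∀ r → r ℕ.* suc r ℕ.+ suc r ℕ.* 2 ≡ suc r ℕ.* suc (suc r)
  arith = solve-∀

module LowerBound (K : ℕ) where

  private
    N r : ℕ
    N = twice (suc (suc K))
    r = suc (suc (twice K))

  length-keys≡target : length (keys r) ≡ target N
  length-keys≡target = ℕP.*-cancelʳ-≡ _ _ 2 (trans (length-keys r) (sym target*2))
    where
    arith : ∀ K → suc (suc (suc (K ℕ.+ K))) ℕ.* suc K ℕ.* 2 ≡ suc (suc (K ℕ.+ K)) ℕ.* suc (suc (suc (K ℕ.+ K)))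
    arith = solve-∀
    target*2 : target N ℕ.* 2 ≡ r ℕ.* suc r
    target*2 rewrite target-twice K | twice≡+ K = arith K

  open Kernel (≡-dec ℕP._≟_ ℕP._≟_)

  target≤length : ∀ Ss → Determines N Ss → target N ≤ length Ss
  target≤length Ss det = ℕP.≮⇒≥ λ Ss<target → solution-nonzero (kernel (map Csum-functional Ss) (keys r) (keys-unique r)
    (subst₂ _<_ (sym (LP.length-map Csum-functional Ss)) (sym length-keys≡target) Ss<target))
    where
    solution-nonzero : ¬ NontrivialSolution (map Csum-functional Ss) (keys r)
    solution-nonzero (D , zeros , support , (i , j) , ij∈ , D[ij]≢0) = D[ij]≢0 (key-zero ij∈)
      where
      same : ∀ {S} → S ∈ Ss → Csum S (λ _ _ → 0ℚ) ≡ Csum S (curry D)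
      same {S} S∈ = trans (apply-zero (Csum-functional S)) (sym (All.lookup (All.map⁻ zeros) S∈))
      row₁≡0 : ∀ x → curry D 1 x ≡ 0ℚ
      row₁≡0 x = support (1 , x) λ 1x∈ → ℕP.<-irrefl refl (proj₁ (keys-∈ 1x∈))
      key-zero : ∀ {i j} → (i , j) ∈ keys r → D (i , j) ≡ 0ℚ
      key-zero ij∈ with keys-∈ ij∈
      key-zero {suc (suc i)} {suc (suc j)} _ | _ , i<j , j≤N = begin
        D (suc (suc i) , suc (suc j))                          ≡⟨ sym (Ctilde-rowOneZero N (curry D) row₁≡0 i j) ⟩
        Ctilde N (curry D) (suc (suc i)) (suc (suc j))         ≡⟨ sym (det (λ _ _ → 0ℚ) (curry D) same _ _ (s≤s z≤n) i<j j≤N) ⟩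
        Ctilde N (λ _ _ → 0ℚ) (suc (suc i)) (suc (suc j))      ≡⟨ Ctilde-rowOneZero N (λ _ _ → 0ℚ) (λ _ → refl) i j ⟩
        0ℚ                                                     ∎
        where open ≡-Reasoning
      key-zero {zero}        {_} _ | () , _
      key-zero {suc zero}    {_} _ | s≤s () , _
      key-zero {suc (suc _)} {zero} _ | _ , () , _
      key-zero {suc (suc _)} {suc zero} _ | _ , s≤s () , _

even≥4⇒twice : ∀ {N} → 4 ≤ N → 2 ∣ N → Σ[ K ∈ ℕ ] N ≡ twice (suc (suc K))
even≥4⇒twice 4≤N (divides (suc (suc K)) refl) = K , trans (ℕP.*-comm (suc (suc K)) 2) (sym (trans (twice≡+ (suc (suc K))) (cong (suc (suc K) ℕ.+_) (sym (ℕP.+-identityʳ _)))))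
even≥4⇒twice (s≤s (s≤s ())) (divides (suc zero) refl)
even≥4⇒twice () (divides zero refl)

theorem1 : (N : ℕ) → 4 ≤ N → 2 ∣ N →
    (Σ[ Ss ∈ List (Pairing N) ] (length Ss ≡ target N × Determines N Ss))
    × (∀ (Ss : List (Pairing N)) → Determines N Ss → target N ≤ length Ss)
theorem1 N 4≤N 2∣N with even≥4⇒twice 4≤N 2∣N
... | K , refl = (witnesses , length-witnesses , determines) , target≤length
  where
  open UpperBound K
  open LowerBound K
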